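{- Let $1 \le \ell < n$ be positive integers. Then \[ {}_2F_2\left(\begin{matrix} \frac{n-1}{n}\ell + 1, & 1 \\ \ell+2, & \frac{n-1}{n}\ell+3 \end{matrix}\, ;\, \frac{\ell}{n} \right) \] equals \[ (\ell+1)!\,\frac{ n^{\ell+1}}{\ell^{\ell+1}}\, \frac{\Gamma(\frac{n-1}{n}\ell+3)}{\Gamma(\frac{n-1}{n}\ell+1)} \left[ \frac{n}{\ell}\left( \sum_{k=0}^{\ell} \frac{\ell^k}{k!\, n^k} - e^{\frac{\ell}n}\right) + \frac{\ell^{\ell-1}}{(\ell-1)!\, n^{\ell-1}} \cdot \frac{1}{(n+1)(\ell+1)-1-2\ell} \right]. \]
   Context: ${}_2F_2\left(\begin{matrix} a_1,a_2 \\ b_1,b_2\end{matrix};x\right)=\sum_{k\ge0}\frac{(a_1)_k(a_2)_k}{(b_1)_k(b_2)_k}\frac{x^k}{k!}$ is the generalized hypergeometric series, where $(a)_0=1$ and $(a)_k=a(a+1)\cdots(a+k-1)$. $\Gamma$ is the Euler gamma function. -}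

module Defs where

open import Data.Nat as ℕ using (ℕ; zero; suc)
open import Data.Nat.Base using () renaming (_! to _!ℕ)
open import Data.Integer as ℤ using (ℤ; +_; +[1+_]; -[1+_])
open import Data.Rational as ℚ using (ℚ; mkℚ; 0ℚ; 1ℚ; _+_; _*_; _-_; 1/_; ∣_∣; _<_)
open import Data.Product using (Σ; _×_)

⟦_⟧ : ℕ → ℚ
⟦ k ⟧ = (+ k) ℚ./ 1

-- total inverse (inverse of 0 is 0; only ever applied to nonzero values below)
inv : ℚ → ℚ
inv (mkℚ (+ zero) d c) = 0ℚ
inv p@(mkℚ +[1+ n ] d c) = 1/ p
inv p@(mkℚ -[1+ n ] d c) = 1/ p

infixl 7 _⊘_
_⊘_ : ℚ → ℚ → ℚ
p ⊘ q = p * inv q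

_^_ : ℚ → ℕ → ℚ
p ^ zero = 1ℚ
p ^ suc k = p * (p ^ k)

fac : ℕ → ℚ
fac k = ⟦ k !ℕ ⟧

poch : ℚ → ℕ → ℚ
poch a zero = 1ℚ
poch a (suc k) = poch a k * (a + ⟦ k ⟧)

sumTo : ℕ → (ℕ → ℚ) → ℚ
sumTo zero f = 0ℚ
sumTo (suc m) f = sumTo m f + f m

term22 : ℚ → ℚ → ℚ → ℚ → ℚ → ℕ → ℚ
term22 a₁ a₂ b₁ b₂ x k =
  (poch a₁ k * poch a₂ k) ⊘ (poch b₁ k * poch b₂ k) * ((x ^ k) ⊘ fac k)

F22partial : ℚ → ℚ → ℚ → ℚ → ℚ → ℕ → ℚ
F22partial a₁ a₂ b₁ b₂ x m = sumTo m (term22 a₁ a₂ b₁ b₂ x)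

expPartial : ℚ → ℕ → ℚ
expPartial x m = sumTo m (λ k → (x ^ k) ⊘ fac k)

-- Sequences of rationals as representatives of real numbers
IsCauchy : (ℕ → ℚ) → Set
IsCauchy f = ∀ (ε : ℚ) → 0ℚ < ε → Σ ℕ λ N → ∀ i j → N ℕ.≤ i → N ℕ.≤ j → ∣ f i - f j ∣ < ε

LimEq : (ℕ → ℚ) → (ℕ → ℚ) → Set
LimEq f g = ∀ (ε : ℚ) → 0ℚ < ε → Σ ℕ λ N → ∀ m → N ℕ.≤ m → ∣ f m - g m ∣ < ε

alpha : ℕ → ℕ → ℚ
alpha ℓ n = (⟦ n ⟧ - 1ℚ) ⊘ ⟦ n ⟧ * ⟦ ℓ ⟧ + 1ℚ

xval : ℕ → ℕ → ℚ
xval ℓ n = ⟦ ℓ ⟧ ⊘ ⟦ n ⟧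

lhsPartial : ℕ → ℕ → ℕ → ℚ
lhsPartial ℓ n =
  F22partial (alpha ℓ n) 1ℚ (⟦ ℓ ⟧ + ⟦ 2 ⟧) (alpha ℓ n + ⟦ 2 ⟧) (xval ℓ n)

-- Γ(α+2)/Γ(α), written via the functional equation Γ(z+1) = z Γ(z)
gammaRatio : ℕ → ℕ → ℚ
gammaRatio ℓ n = alpha ℓ n * (alpha ℓ n + 1ℚ)

-- RHS with e^{ℓ/n} replaced by its m-th partial sum
rhsPartial : ℕ → ℕ → ℕ → ℚ
rhsPartial ℓ n m =
  fac (suc ℓ) * ((⟦ n ⟧ ^ suc ℓ) ⊘ (⟦ ℓ ⟧ ^ suc ℓ)) * gammaRatio ℓ n *
  ( (⟦ n ⟧ ⊘ ⟦ ℓ ⟧) * (expPartial (xval ℓ n) (suc ℓ) - expPartial (xval ℓ n) m)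
  + ((⟦ ℓ ⟧ ^ (ℓ ℕ.∸ 1)) ⊘ (fac (ℓ ℕ.∸ 1) * (⟦ n ⟧ ^ (ℓ ℕ.∸ 1))))
    * inv ((⟦ n ⟧ + 1ℚ) * (⟦ ℓ ⟧ + 1ℚ) - 1ℚ - ⟦ 2 ⟧ * ⟦ ℓ ⟧) )

{-# OPTIONS --safe #-}

-- Put x = ℓ/n, α = ℓ + 1 - x (which is (n-1)ℓ/n + 1) and w k = xᵏ/k!. Since
-- (α)ₘ/(α+2)ₘ = α(α+1)/((α+m)(α+m+1)) and (1)ₘ/(ℓ+2)ₘ = m!(ℓ+1)!/(ℓ+1+m)!, the m-th term of the
-- ₂F₂ series is C·w j/((j-x)(j+1-x)) with j = ℓ+1+m and C = (ℓ+1)!·α(α+1)/x^(ℓ+1), the prefactor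
-- of the right-hand side. As w j = x·w (j-1)/j, partial fractions turn this term into
-- C·(potential (j-1) - potential j), where potential k = w k/(k+1-x) + (1/x)·Σ_{i≤k} w i, so the
-- partial sums telescope to C·(potential ℓ - potential (ℓ+m)). The last summand of the right-hand
-- side is w ℓ/(ℓ+1-x), so with e^x truncated to m terms the right-hand side is
-- C·(potential ℓ - (1/x)·Σ_{i<m} w i), and the two differ by
-- -C·(w (ℓ+m)/(ℓ+m+1-x) + (1/x)·Σ_{m≤i≤ℓ+m} w i). Because 0 < x < 1 gives w i ≤ 1/i, this is
-- O(1/m), and the same bound makes the partial sums Cauchy.

module Submission where

open import Defs
open import Data.Nat using (ℕ; _≤_; _<_)
open import Data.Product using (_×_)

open import Data.Nat as ℕ using (zero; suc; z≤n; s≤s; _!)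
import Data.Nat.Properties as ℕ
open import Data.Nat.Coprimality as Coprime using (Coprime; 1-coprimeTo)
open import Data.Integer as ℤ using (+_; +[1+_]; -[1+_])
import Data.Integer.Properties as ℤ
open import Data.Rational as ℚ using (ℚ; mkℚ; 0ℚ; 1ℚ; _+_; _*_; _-_; -_; ∣_∣)
import Data.Rational.Properties as ℚ
open import Data.Product using (Σ; _,_; proj₁; proj₂)
open import Data.Sum using (inj₁; inj₂)
open import Data.Empty using (⊥-elim)
open import Level using (0ℓ)
open import Relation.Nullary using (yes; no)
open import Relation.Nullary.Decidable using (dec⇒maybe)
open import Relation.Binary.PropositionalEquality
  using (_≡_; _≢_; refl; sym; trans; cong; cong₂; subst; subst₂; ≢-sym; module ≡-Reasoning)
open import Tactic.RingSolver using (solve-∀)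
import Tactic.RingSolver.Core.AlmostCommutativeRing as ACR

ℚ-ring : ACR.AlmostCommutativeRing 0ℓ 0ℓ
ℚ-ring = ACR.fromCommutativeRing ℚ.+-*-commutativeRing (λ q → dec⇒maybe (0ℚ ℚ.≟ q))

coprime-1 : ∀ k → Coprime k 1
coprime-1 k = Coprime.sym (1-coprimeTo k)

⟦⟧-mkℚ : ∀ k → ⟦ k ⟧ ≡ mkℚ (+ k) 0 (coprime-1 k)
⟦⟧-mkℚ k = ℚ.normalize-coprime (coprime-1 k)

⟦⟧-homo-+ : ∀ a b → ⟦ a ℕ.+ b ⟧ ≡ ⟦ a ⟧ + ⟦ b ⟧
⟦⟧-homo-+ a b = begin
  ⟦ a ℕ.+ b ⟧
    ≡⟨ cong₂ (λ i j → (i ℤ.+ j) ℚ./ 1) (sym (ℤ.*-identityʳ (+ a))) (sym (ℤ.*-identityʳ (+ b))) ⟩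
  mkℚ (+ a) 0 (coprime-1 a) + mkℚ (+ b) 0 (coprime-1 b)
    ≡⟨ cong₂ _+_ (sym (⟦⟧-mkℚ a)) (sym (⟦⟧-mkℚ b)) ⟩
  ⟦ a ⟧ + ⟦ b ⟧
    ∎
  where open ≡-Reasoning

⟦⟧-homo-* : ∀ a b → ⟦ a ℕ.* b ⟧ ≡ ⟦ a ⟧ * ⟦ b ⟧
⟦⟧-homo-* a b = begin
  ⟦ a ℕ.* b ⟧
    ≡⟨ cong (ℚ._/ 1) (ℤ.pos-* a b) ⟩
  mkℚ (+ a) 0 (coprime-1 a) * mkℚ (+ b) 0 (coprime-1 b)
    ≡⟨ cong₂ _*_ (sym (⟦⟧-mkℚ a)) (sym (⟦⟧-mkℚ b)) ⟩
  ⟦ a ⟧ * ⟦ b ⟧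
    ∎
  where open ≡-Reasoning

⟦⟧-suc : ∀ k → ⟦ suc k ⟧ ≡ 1ℚ + ⟦ k ⟧
⟦⟧-suc = ⟦⟧-homo-+ 1

⟦⟧-nonNeg : ∀ k → 0ℚ ℚ.≤ ⟦ k ⟧
⟦⟧-nonNeg k rewrite ⟦⟧-mkℚ k = ℚ.nonNegative⁻¹ _

⟦⟧-pos : ∀ {k} → 1 ≤ k → 0ℚ ℚ.< ⟦ k ⟧
⟦⟧-pos {suc k} _ rewrite ⟦⟧-mkℚ (suc k) = ℚ.positive⁻¹ _

⟦⟧-mono-≤ : ∀ {a b} → a ≤ b → ⟦ a ⟧ ℚ.≤ ⟦ b ⟧
⟦⟧-mono-≤ {a} {b} a≤b = begin
  ⟦ a ⟧                 ≡⟨ ℚ.+-identityʳ ⟦ a ⟧ ⟨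
  ⟦ a ⟧ + 0ℚ            ≤⟨ ℚ.+-monoʳ-≤ ⟦ a ⟧ (⟦⟧-nonNeg (b ℕ.∸ a)) ⟩
  ⟦ a ⟧ + ⟦ b ℕ.∸ a ⟧   ≡⟨ ⟦⟧-homo-+ a (b ℕ.∸ a) ⟨
  ⟦ a ℕ.+ (b ℕ.∸ a) ⟧   ≡⟨ cong ⟦_⟧ (ℕ.m+[n∸m]≡n a≤b) ⟩
  ⟦ b ⟧                 ∎
  where open ℚ.≤-Reasoning

⟦⟧-mono-< : ∀ {a b} → a < b → ⟦ a ⟧ ℚ.< ⟦ b ⟧
⟦⟧-mono-< {a} {b} a<b = begin-strict
  ⟦ a ⟧                 ≡⟨ ℚ.+-identityʳ ⟦ a ⟧ ⟨
  ⟦ a ⟧ + 0ℚ            <⟨ ℚ.+-monoʳ-< ⟦ a ⟧ (ℚ.positive⁻¹ 1ℚ) ⟩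
  ⟦ a ⟧ + 1ℚ            ≡⟨ trans (ℚ.+-comm ⟦ a ⟧ 1ℚ) (sym (⟦⟧-suc a)) ⟩
  ⟦ suc a ⟧             ≤⟨ ⟦⟧-mono-≤ a<b ⟩
  ⟦ b ⟧                 ∎
  where open ℚ.≤-Reasoning

pos⇒≢0 : ∀ {q} → 0ℚ ℚ.< q → q ≢ 0ℚ
pos⇒≢0 0<q = ≢-sym (ℚ.<⇒≢ 0<q)

*-pos : ∀ {p q} → 0ℚ ℚ.< p → 0ℚ ℚ.< q → 0ℚ ℚ.< p * q
*-pos {p} {q} 0<p 0<q =
  ℚ.positive⁻¹ _ {{ℚ.pos*pos⇒pos p {{ℚ.positive 0<p}} q {{ℚ.positive 0<q}}}}

*-nonNeg : ∀ {p q} → 0ℚ ℚ.≤ p → 0ℚ ℚ.≤ q → 0ℚ ℚ.≤ p * q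
*-nonNeg {p} {q} 0≤p 0≤q =
  ℚ.nonNegative⁻¹ _ {{ℚ.nonNeg*nonNeg⇒nonNeg p {{ℚ.nonNegative 0≤p}} q {{ℚ.nonNegative 0≤q}}}}

+-pos : ∀ {p q} → 0ℚ ℚ.< p → 0ℚ ℚ.≤ q → 0ℚ ℚ.< p + q
+-pos {p} {q} 0<p 0≤q =
  ℚ.positive⁻¹ _ {{ℚ.pos+nonNeg⇒pos p {{ℚ.positive 0<p}} q {{ℚ.nonNegative 0≤q}}}}

+-nonNeg : ∀ {p q} → 0ℚ ℚ.≤ p → 0ℚ ℚ.≤ q → 0ℚ ℚ.≤ p + q
+-nonNeg {p} {q} 0≤p 0≤q =
  ℚ.nonNegative⁻¹ _ {{ℚ.nonNeg+nonNeg⇒nonNeg p {{ℚ.nonNegative 0≤p}} q {{ℚ.nonNegative 0≤q}}}}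

p≤q⇒0≤q-p : ∀ {p q} → p ℚ.≤ q → 0ℚ ℚ.≤ q - p
p≤q⇒0≤q-p {p} {q} p≤q = subst (ℚ._≤ q - p) (ℚ.+-inverseʳ p) (ℚ.+-monoˡ-≤ (- p) p≤q)

p<q⇒0<q-p : ∀ {p q} → p ℚ.< q → 0ℚ ℚ.< q - p
p<q⇒0<q-p {p} {q} p<q = subst (ℚ._< q - p) (ℚ.+-inverseʳ p) (ℚ.+-monoˡ-< (- p) p<q)

inv-inverseʳ : ∀ q → q ≢ 0ℚ → q * inv q ≡ 1ℚ
inv-inverseʳ q@(mkℚ (+ zero) _ _) q≢0 = ⊥-elim (q≢0 (ℚ.↥p≡0⇒p≡0 q refl))
inv-inverseʳ q@(mkℚ +[1+ _ ] _ _) _   = ℚ.*-inverseʳ q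
inv-inverseʳ q@(mkℚ -[1+ _ ] _ _) _   = ℚ.*-inverseʳ q

inv-unique : ∀ q {r} → q * r ≡ 1ℚ → inv q ≡ r
inv-unique q {r} qr≡1 = begin
  inv q              ≡⟨ ℚ.*-identityʳ (inv q) ⟨
  inv q * 1ℚ         ≡⟨ cong (inv q *_) qr≡1 ⟨
  inv q * (q * r)    ≡⟨ ℚ.*-assoc (inv q) q r ⟨
  inv q * q * r      ≡⟨ cong (_* r) (trans (ℚ.*-comm (inv q) q) (inv-inverseʳ q q≢0)) ⟩
  1ℚ * r             ≡⟨ ℚ.*-identityˡ r ⟩
  r                  ∎
  where
  open ≡-Reasoning
  q≢0 : q ≢ 0ℚ
  q≢0 refl = ℚ.1≢0 (trans (sym qr≡1) (ℚ.*-zeroˡ r))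

-- Thanks to the junk value inv 0ℚ = 0ℚ, the laws up to inv-⊘ need no side conditions.
inv-* : ∀ p q → inv (p * q) ≡ inv p * inv q
inv-* p q with p ℚ.≟ 0ℚ | q ℚ.≟ 0ℚ
... | yes refl | _      = trans (cong inv (ℚ.*-zeroˡ q)) (sym (ℚ.*-zeroˡ (inv q)))
... | no _     | yes refl = trans (cong inv (ℚ.*-zeroʳ p)) (sym (ℚ.*-zeroʳ (inv p)))
... | no p≢0   | no q≢0 = inv-unique (p * q) (begin
  p * q * (inv p * inv q)      ≡⟨ interchange p q (inv p) (inv q) ⟩
  (p * inv p) * (q * inv q)    ≡⟨ cong₂ _*_ (inv-inverseʳ p p≢0) (inv-inverseʳ q q≢0) ⟩
  1ℚ                           ∎)
  where
  open ≡-Reasoning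
  interchange : ∀ a b c d → a * b * (c * d) ≡ (a * c) * (b * d)
  interchange = solve-∀ ℚ-ring

inv-involutive : ∀ q → inv (inv q) ≡ q
inv-involutive q with q ℚ.≟ 0ℚ
... | yes refl = refl
... | no q≢0   = inv-unique (inv q) (trans (ℚ.*-comm (inv q) q) (inv-inverseʳ q q≢0))

inv-pow : ∀ q k → inv (q ^ k) ≡ inv q ^ k
inv-pow q zero    = refl
inv-pow q (suc k) = trans (inv-* q (q ^ k)) (cong (inv q *_) (inv-pow q k))

inv-⊘ : ∀ p q → inv (p ⊘ q) ≡ q ⊘ p
inv-⊘ p q = trans (inv-* p (inv q)) (trans (cong (inv p *_) (inv-involutive q)) (ℚ.*-comm (inv p) q))

⊘-*-cancel : ∀ p {q} → q ≢ 0ℚ → p ⊘ q * q ≡ p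
⊘-*-cancel p {q} q≢0 = begin
  p * inv q * q     ≡⟨ ℚ.*-assoc p (inv q) q ⟩
  p * (inv q * q)   ≡⟨ cong (p *_) (trans (ℚ.*-comm (inv q) q) (inv-inverseʳ q q≢0)) ⟩
  p * 1ℚ            ≡⟨ ℚ.*-identityʳ p ⟩
  p                 ∎
  where open ≡-Reasoning

⊘-cross : ∀ {a b c d} → b ≢ 0ℚ → d ≢ 0ℚ → a * d ≡ c * b → a ⊘ b ≡ c ⊘ d
⊘-cross {a} {b} {c} {d} b≢0 d≢0 ad≡cb = begin
  a ⊘ b              ≡⟨ ⊘-*-cancel (a ⊘ b) d≢0 ⟨
  a ⊘ b ⊘ d * d      ≡⟨ move-last a (inv b) (inv d) d ⟩
  a * d ⊘ b ⊘ d      ≡⟨ cong (λ e → e ⊘ b ⊘ d) ad≡cb ⟩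
  c * b ⊘ b ⊘ d      ≡⟨ swap-middle c b (inv b) (inv d) ⟩
  c ⊘ b * b ⊘ d      ≡⟨ cong (_⊘ d) (⊘-*-cancel c b≢0) ⟩
  c ⊘ d              ∎
  where
  open ≡-Reasoning
  move-last : ∀ p q r s → p * q * r * s ≡ p * s * q * r
  move-last = solve-∀ ℚ-ring
  swap-middle : ∀ p q r s → p * q * r * s ≡ p * r * q * s
  swap-middle = solve-∀ ℚ-ring

inv-pos : ∀ {q} → 0ℚ ℚ.< q → 0ℚ ℚ.< inv q
inv-pos {mkℚ (+ zero) _ _} (ℚ.*<* (ℤ.+<+ ()))
inv-pos {q@(mkℚ +[1+ _ ] _ _)} _   = ℚ.positive⁻¹ _ {{ℚ.1/pos⇒pos q}}
inv-pos {q@(mkℚ -[1+ _ ] _ _)} 0<q = ⊥-elim (ℚ.<-asym 0<q (ℚ.negative⁻¹ q))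

*-monoˡ-≤-0≤ : ∀ {r p q} → 0ℚ ℚ.≤ r → p ℚ.≤ q → r * p ℚ.≤ r * q
*-monoˡ-≤-0≤ {r} 0≤r = ℚ.*-monoˡ-≤-nonNeg r {{ℚ.nonNegative 0≤r}}

*-monoʳ-≤-0≤ : ∀ {r p q} → 0ℚ ℚ.≤ r → p ℚ.≤ q → p * r ℚ.≤ q * r
*-monoʳ-≤-0≤ {r} 0≤r = ℚ.*-monoʳ-≤-nonNeg r {{ℚ.nonNegative 0≤r}}

inv-antimono-≤ : ∀ {p q} → 0ℚ ℚ.< p → p ℚ.≤ q → inv q ℚ.≤ inv p
inv-antimono-≤ {p} {q} 0<p p≤q = begin
  inv q                ≡⟨ ℚ.*-identityʳ (inv q) ⟨
  inv q * 1ℚ           ≡⟨ cong (inv q *_) (inv-inverseʳ p (pos⇒≢0 0<p)) ⟨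
  inv q * (p * inv p)  ≡⟨ ℚ.*-assoc (inv q) p (inv p) ⟨
  inv q * p * inv p    ≤⟨ *-monoʳ-≤-0≤ (ℚ.<⇒≤ (inv-pos 0<p)) (*-monoˡ-≤-0≤ (ℚ.<⇒≤ (inv-pos 0<q)) p≤q) ⟩
  inv q * q * inv p    ≡⟨ cong (_* inv p) (trans (ℚ.*-comm (inv q) q) (inv-inverseʳ q (pos⇒≢0 0<q))) ⟩
  1ℚ * inv p           ≡⟨ ℚ.*-identityˡ (inv p) ⟩
  inv p                ∎
  where
  open ℚ.≤-Reasoning
  0<q : 0ℚ ℚ.< q
  0<q = ℚ.<-≤-trans 0<p p≤q

pow-+ : ∀ p a b → p ^ (a ℕ.+ b) ≡ p ^ a * p ^ b
pow-+ p zero    b = sym (ℚ.*-identityˡ (p ^ b))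
pow-+ p (suc a) b = trans (cong (p *_) (pow-+ p a b)) (sym (ℚ.*-assoc p (p ^ a) (p ^ b)))

pow-* : ∀ p q k → (p * q) ^ k ≡ p ^ k * q ^ k
pow-* p q zero    = refl
pow-* p q (suc k) = trans (cong (p * q *_) (pow-* p q k)) (interchange p q (p ^ k) (q ^ k))
  where
  interchange : ∀ a b c d → a * b * (c * d) ≡ (a * c) * (b * d)
  interchange = solve-∀ ℚ-ring

pow-nonNeg : ∀ {p} k → 0ℚ ℚ.≤ p → 0ℚ ℚ.≤ p ^ k
pow-nonNeg zero    _   = ℚ.nonNegative⁻¹ 1ℚ
pow-nonNeg (suc k) 0≤p = *-nonNeg 0≤p (pow-nonNeg k 0≤p)

pow-pos : ∀ {p} k → 0ℚ ℚ.< p → 0ℚ ℚ.< p ^ k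
pow-pos zero    _   = ℚ.positive⁻¹ 1ℚ
pow-pos (suc k) 0<p = *-pos 0<p (pow-pos k 0<p)

pow-≤-1 : ∀ {p} k → 0ℚ ℚ.≤ p → p ℚ.≤ 1ℚ → p ^ k ℚ.≤ 1ℚ
pow-≤-1         zero    _   _   = ℚ.≤-refl
pow-≤-1 {p} (suc k) 0≤p p≤1 = begin
  p * p ^ k  ≤⟨ *-monoˡ-≤-0≤ 0≤p (pow-≤-1 k 0≤p p≤1) ⟩
  p * 1ℚ     ≡⟨ ℚ.*-identityʳ p ⟩
  p          ≤⟨ p≤1 ⟩
  1ℚ         ∎
  where open ℚ.≤-Reasoning

fac-suc : ∀ k → fac (suc k) ≡ ⟦ suc k ⟧ * fac k
fac-suc k = ⟦⟧-homo-* (suc k) (k !)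

fac-pos : ∀ k → 0ℚ ℚ.< fac k
fac-pos k = ⟦⟧-pos (ℕ.1≤n! k)

⟦⟧-≤-fac : ∀ k → ⟦ k ⟧ ℚ.≤ fac k
⟦⟧-≤-fac k = ⟦⟧-mono-≤ (n≤n! k)
  where
  n≤n! : ∀ n → n ≤ n !
  n≤n! zero    = z≤n
  n≤n! (suc n) = ℕ.m≤m*n (suc n) (n !) {{n ℕ.!≢0}}

poch-1 : ∀ k → poch 1ℚ k ≡ fac k
poch-1 zero    = refl
poch-1 (suc k) = begin
  poch 1ℚ k * (1ℚ + ⟦ k ⟧)  ≡⟨ cong₂ _*_ (poch-1 k) (sym (⟦⟧-suc k)) ⟩
  fac k * ⟦ suc k ⟧         ≡⟨ ℚ.*-comm (fac k) ⟦ suc k ⟧ ⟩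
  ⟦ suc k ⟧ * fac k         ≡⟨ fac-suc k ⟨
  fac (suc k)               ∎
  where open ≡-Reasoning

poch-pos : ∀ {a} k → 0ℚ ℚ.< a → 0ℚ ℚ.< poch a k
poch-pos zero    _   = ℚ.positive⁻¹ 1ℚ
poch-pos (suc k) 0<a = *-pos (poch-pos k 0<a) (+-pos 0<a (⟦⟧-nonNeg k))

-- Both sides are (a)ₖ₊₂.
poch-shift-2 : ∀ a k → poch a k * ((a + ⟦ k ⟧) * (a + ⟦ k ⟧ + 1ℚ)) ≡ a * (a + 1ℚ) * poch (a + ⟦ 2 ⟧) k
poch-shift-2 a zero    = base a
  where
  base : ∀ a → 1ℚ * ((a + 0ℚ) * (a + 0ℚ + 1ℚ)) ≡ a * (a + 1ℚ) * 1ℚ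
  base = solve-∀ ℚ-ring
poch-shift-2 a (suc k) = begin
  poch a k * (a + ⟦ k ⟧) * ((a + ⟦ suc k ⟧) * (a + ⟦ suc k ⟧ + 1ℚ))
    ≡⟨ cong (λ s → poch a k * (a + ⟦ k ⟧) * ((a + s) * (a + s + 1ℚ))) (⟦⟧-suc k) ⟩
  poch a k * (a + ⟦ k ⟧) * ((a + (1ℚ + ⟦ k ⟧)) * (a + (1ℚ + ⟦ k ⟧) + 1ℚ))
    ≡⟨ regroup (poch a k) a ⟦ k ⟧ ⟩
  poch a k * ((a + ⟦ k ⟧) * (a + ⟦ k ⟧ + 1ℚ)) * (a + ⟦ 2 ⟧ + ⟦ k ⟧)
    ≡⟨ cong (_* (a + ⟦ 2 ⟧ + ⟦ k ⟧)) (poch-shift-2 a k) ⟩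
  a * (a + 1ℚ) * poch (a + ⟦ 2 ⟧) k * (a + ⟦ 2 ⟧ + ⟦ k ⟧)
    ≡⟨ ℚ.*-assoc (a * (a + 1ℚ)) (poch (a + ⟦ 2 ⟧) k) (a + ⟦ 2 ⟧ + ⟦ k ⟧) ⟩
  a * (a + 1ℚ) * poch (a + ⟦ 2 ⟧) (suc k) ∎
  where
  open ≡-Reasoning
  regroup : ∀ P a K → P * (a + K) * ((a + (1ℚ + K)) * (a + (1ℚ + K) + 1ℚ))
                    ≡ P * ((a + K) * (a + K + 1ℚ)) * (a + ⟦ 2 ⟧ + K)
  regroup = solve-∀ ℚ-ring

poch-fac : ∀ j k → poch ⟦ suc j ⟧ k * fac j ≡ fac (j ℕ.+ k)
poch-fac j zero    = trans (ℚ.*-identityˡ (fac j)) (cong fac (sym (ℕ.+-identityʳ j)))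
poch-fac j (suc k) = begin
  poch ⟦ suc j ⟧ k * (⟦ suc j ⟧ + ⟦ k ⟧) * fac j  ≡⟨ swap (poch ⟦ suc j ⟧ k) (⟦ suc j ⟧ + ⟦ k ⟧) (fac j) ⟩
  (⟦ suc j ⟧ + ⟦ k ⟧) * (poch ⟦ suc j ⟧ k * fac j) ≡⟨ cong₂ _*_ (sym (⟦⟧-homo-+ (suc j) k)) (poch-fac j k) ⟩
  ⟦ suc (j ℕ.+ k) ⟧ * fac (j ℕ.+ k)               ≡⟨ fac-suc (j ℕ.+ k) ⟨
  fac (suc (j ℕ.+ k))                             ≡⟨ cong fac (ℕ.+-suc j k) ⟨
  fac (j ℕ.+ suc k)                               ∎
  where
  open ≡-Reasoning
  swap : ∀ a b c → a * b * c ≡ b * (a * c)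
  swap = solve-∀ ℚ-ring

poch-ratio-shift-2 : ∀ {a} k → 0ℚ ℚ.< a →
                     poch a k ⊘ poch (a + ⟦ 2 ⟧) k ≡ a * (a + 1ℚ) ⊘ ((a + ⟦ k ⟧) * (a + ⟦ k ⟧ + 1ℚ))
poch-ratio-shift-2 {a} k 0<a =
  ⊘-cross {poch a k} {c = a * (a + 1ℚ)} (pos⇒≢0 (poch-pos k 0<a+2)) (pos⇒≢0 0<D) (poch-shift-2 a k)
  where
  0<a+k : 0ℚ ℚ.< a + ⟦ k ⟧
  0<a+k = +-pos 0<a (⟦⟧-nonNeg k)
  0<a+2 : 0ℚ ℚ.< a + ⟦ 2 ⟧
  0<a+2 = +-pos 0<a (⟦⟧-nonNeg 2)
  0<D : 0ℚ ℚ.< (a + ⟦ k ⟧) * (a + ⟦ k ⟧ + 1ℚ)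
  0<D = *-pos 0<a+k (+-pos 0<a+k (ℚ.nonNegative⁻¹ 1ℚ))

inv-poch-⟦⟧ : ∀ j k → inv (poch ⟦ suc j ⟧ k) ≡ fac j ⊘ fac (j ℕ.+ k)
inv-poch-⟦⟧ j k = inv-unique (poch ⟦ suc j ⟧ k) (begin
  poch ⟦ suc j ⟧ k * (fac j ⊘ fac (j ℕ.+ k))   ≡⟨ ℚ.*-assoc (poch ⟦ suc j ⟧ k) (fac j) (inv (fac (j ℕ.+ k))) ⟨
  poch ⟦ suc j ⟧ k * fac j ⊘ fac (j ℕ.+ k)     ≡⟨ cong (_⊘ fac (j ℕ.+ k)) (poch-fac j k) ⟩
  fac (j ℕ.+ k) ⊘ fac (j ℕ.+ k)                ≡⟨ inv-inverseʳ (fac (j ℕ.+ k)) (pos⇒≢0 (fac-pos (j ℕ.+ k))) ⟩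
  1ℚ                                           ∎)
  where open ≡-Reasoning

sumTo-telescope : ∀ c (v f : ℕ → ℚ) → (∀ k → f k ≡ c * (v k - v (suc k))) →
                  ∀ m → sumTo m f ≡ c * (v 0 - v m)
sumTo-telescope c v f f≡ zero    = empty c (v 0)
  where
  empty : ∀ c a → 0ℚ ≡ c * (a - a)
  empty = solve-∀ ℚ-ring
sumTo-telescope c v f f≡ (suc m) = begin
  sumTo m f + f m                                ≡⟨ cong₂ _+_ (sumTo-telescope c v f f≡ m) (f≡ m) ⟩
  c * (v 0 - v m) + c * (v m - v (suc m))        ≡⟨ collapse c (v 0) (v m) (v (suc m)) ⟩
  c * (v 0 - v (suc m))                          ∎
  where
  open ≡-Reasoning
  collapse : ∀ c a b d → c * (a - b) + c * (b - d) ≡ c * (a - d)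
  collapse = solve-∀ ℚ-ring

sumTo-mono-≤ : ∀ {f} → (∀ k → 0ℚ ℚ.≤ f k) → ∀ {m m′} → m ≤ m′ → sumTo m f ℚ.≤ sumTo m′ f
sumTo-mono-≤ {f} 0≤f {m} {m′} m≤m′ =
  subst (λ i → sumTo m f ℚ.≤ sumTo i f) (ℕ.m∸n+n≡m m≤m′) (extend (m′ ℕ.∸ m))
  where
  extend : ∀ d → sumTo m f ℚ.≤ sumTo (d ℕ.+ m) f
  extend zero    = ℚ.≤-refl
  extend (suc d) = begin
    sumTo m f                    ≤⟨ extend d ⟩
    sumTo (d ℕ.+ m) f            ≡⟨ ℚ.+-identityʳ (sumTo (d ℕ.+ m) f) ⟨
    sumTo (d ℕ.+ m) f + 0ℚ       ≤⟨ ℚ.+-monoʳ-≤ (sumTo (d ℕ.+ m) f) (0≤f (d ℕ.+ m)) ⟩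
    sumTo (suc d ℕ.+ m) f        ∎
    where open ℚ.≤-Reasoning

sumTo-tail-≤ : ∀ {f c m} → (∀ k → m ≤ k → f k ℚ.≤ c) →
               ∀ d → sumTo (d ℕ.+ m) f - sumTo m f ℚ.≤ ⟦ d ⟧ * c
sumTo-tail-≤ {f} {c} {m} f≤c zero    =
  ℚ.≤-reflexive (trans (ℚ.+-inverseʳ (sumTo m f)) (sym (ℚ.*-zeroˡ c)))
sumTo-tail-≤ {f} {c} {m} f≤c (suc d) = begin
  sumTo (d ℕ.+ m) f + f (d ℕ.+ m) - sumTo m f
    ≡⟨ shuffle (sumTo (d ℕ.+ m) f) (f (d ℕ.+ m)) (sumTo m f) ⟩
  (sumTo (d ℕ.+ m) f - sumTo m f) + f (d ℕ.+ m)
    ≤⟨ ℚ.+-mono-≤ (sumTo-tail-≤ f≤c d) (f≤c (d ℕ.+ m) (ℕ.m≤n+m m d)) ⟩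
  ⟦ d ⟧ * c + c
    ≡⟨ collect ⟦ d ⟧ c ⟩
  (1ℚ + ⟦ d ⟧) * c
    ≡⟨ cong (_* c) (⟦⟧-suc d) ⟨
  ⟦ suc d ⟧ * c
    ∎
  where
  open ℚ.≤-Reasoning
  shuffle : ∀ s a t → s + a - t ≡ (s - t) + a
  shuffle = solve-∀ ℚ-ring
  collect : ∀ n c → n * c + c ≡ (1ℚ + n) * c
  collect = solve-∀ ℚ-ring

∣-∣-comm : ∀ p q → ∣ p - q ∣ ≡ ∣ q - p ∣
∣-∣-comm p q = trans (sym (ℚ.∣-p∣≡∣p∣ (p - q))) (cong ∣_∣ (negate p q))
  where
  negate : ∀ p q → - (p - q) ≡ q - p
  negate = solve-∀ ℚ-ring

∣c*p-c*q∣≡c*∣p-q∣ : ∀ {c} → 0ℚ ℚ.≤ c → ∀ p q → ∣ c * p - c * q ∣ ≡ c * ∣ p - q ∣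
∣c*p-c*q∣≡c*∣p-q∣ {c} 0≤c p q = begin
  ∣ c * p - c * q ∣    ≡⟨ cong ∣_∣ (factor c p q) ⟩
  ∣ c * (p - q) ∣      ≡⟨ ℚ.∣p*q∣≡∣p∣*∣q∣ c (p - q) ⟩
  ∣ c ∣ * ∣ p - q ∣    ≡⟨ cong (_* ∣ p - q ∣) (ℚ.0≤p⇒∣p∣≡p 0≤c) ⟩
  c * ∣ p - q ∣        ∎
  where
  open ≡-Reasoning
  factor : ∀ c p q → c * p - c * q ≡ c * (p - q)
  factor = solve-∀ ℚ-ring

archimedean : ∀ q → Σ ℕ λ N → q ℚ.< ⟦ N ⟧
archimedean q@(mkℚ (+ k) d _)  = suc k , ℚ.≤-<-trans q≤k (⟦⟧-mono-< (ℕ.n<1+n k))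
  where
  q≤k : q ℚ.≤ ⟦ k ⟧
  q≤k rewrite ⟦⟧-mkℚ k = ℚ.*≤* (subst₂ ℤ._≤_ (sym (ℤ.*-identityʳ (+ k))) (ℤ.pos-* k (suc d))
                                 (ℤ.+≤+ (ℕ.m≤m*n k (suc d))))
archimedean q@(mkℚ -[1+ _ ] _ _) = 1 , ℚ.<-trans (ℚ.negative⁻¹ q) (ℚ.positive⁻¹ 1ℚ)

harmonic-eventually-< : ∀ {K ε} → 0ℚ ℚ.≤ K → 0ℚ ℚ.< ε →
                        Σ ℕ λ N → ∀ m → suc N ≤ m → K ⊘ ⟦ m ⟧ ℚ.< ε
harmonic-eventually-< {K} {ε} 0≤K 0<ε with archimedean (K ⊘ ε)
... | N , K/ε<N = N , small
  where
  small : ∀ m → suc N ≤ m → K ⊘ ⟦ m ⟧ ℚ.< ε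
  small m N<m = begin-strict
    K ⊘ ⟦ m ⟧               ≡⟨ cong (_⊘ ⟦ m ⟧) (⊘-*-cancel K (pos⇒≢0 0<ε)) ⟨
    K ⊘ ε * ε ⊘ ⟦ m ⟧       ≡⟨ ℚ.*-assoc (K ⊘ ε) ε (inv ⟦ m ⟧) ⟩
    K ⊘ ε * (ε ⊘ ⟦ m ⟧)     <⟨ ℚ.*-monoˡ-<-pos (ε ⊘ ⟦ m ⟧) {{ℚ.positive (*-pos 0<ε (inv-pos 0<m))}}
                                 (ℚ.<-trans K/ε<N (⟦⟧-mono-< N<m)) ⟩
    ⟦ m ⟧ * (ε ⊘ ⟦ m ⟧)     ≡⟨ ℚ.*-comm ⟦ m ⟧ (ε ⊘ ⟦ m ⟧) ⟩
    ε ⊘ ⟦ m ⟧ * ⟦ m ⟧       ≡⟨ ⊘-*-cancel ε (pos⇒≢0 0<m) ⟩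
    ε                       ∎
    where
    open ℚ.≤-Reasoning
    0<m : 0ℚ ℚ.< ⟦ m ⟧
    0<m = ⟦⟧-pos (ℕ.≤-trans (s≤s z≤n) N<m)

cauchy-by-harmonic-bound : ∀ (f : ℕ → ℚ) {K} → 0ℚ ℚ.≤ K →
                           (∀ i j → 1 ≤ i → i ≤ j → ∣ f i - f j ∣ ℚ.≤ K ⊘ ⟦ i ⟧) → IsCauchy f
cauchy-by-harmonic-bound f {K} 0≤K bound ε 0<ε = suc N , close
  where
  N : ℕ
  N = proj₁ (harmonic-eventually-< 0≤K 0<ε)
  small : ∀ m → suc N ≤ m → K ⊘ ⟦ m ⟧ ℚ.< ε
  small = proj₂ (harmonic-eventually-< 0≤K 0<ε)
  ordered : ∀ i j → suc N ≤ i → i ≤ j → ∣ f i - f j ∣ ℚ.< ε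
  ordered i j N<i i≤j = ℚ.≤-<-trans (bound i j (ℕ.≤-trans (s≤s z≤n) N<i) i≤j) (small i N<i)
  close : ∀ i j → suc N ≤ i → suc N ≤ j → ∣ f i - f j ∣ ℚ.< ε
  close i j N<i N<j with ℕ.≤-total i j
  ... | inj₁ i≤j = ordered i j N<i i≤j
  ... | inj₂ j≤i = subst (ℚ._< ε) (∣-∣-comm (f j) (f i)) (ordered j i N<j j≤i)

limEq-by-harmonic-bound : ∀ (f g : ℕ → ℚ) {K} → 0ℚ ℚ.≤ K →
                          (∀ m → 1 ≤ m → ∣ f m - g m ∣ ℚ.≤ K ⊘ ⟦ m ⟧) → LimEq f g
limEq-by-harmonic-bound f g {K} 0≤K bound ε 0<ε = suc N , close
  where
  N : ℕ
  N = proj₁ (harmonic-eventually-< 0≤K 0<ε)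
  close : ∀ m → suc N ≤ m → ∣ f m - g m ∣ ℚ.< ε
  close m N<m =
    ℚ.≤-<-trans (bound m (ℕ.≤-trans (s≤s z≤n) N<m)) (proj₂ (harmonic-eventually-< 0≤K 0<ε) m N<m)

LimEq-congʳ : ∀ {f g h : ℕ → ℚ} → (∀ m → g m ≡ h m) → LimEq f g → LimEq f h
LimEq-congʳ {f} g≡h f~g ε 0<ε =
  proj₁ (f~g ε 0<ε) , λ m N≤m → subst (λ v → ∣ f m - v ∣ ℚ.< ε) (g≡h m) (proj₂ (f~g ε 0<ε) m N≤m)

-- Multiplied by P Q J this is the polynomial identity Q J - x P - P Q = x, where P = J - x and
-- Q = P + 1; G records where the three unit factors P iP, Q iQ and J iJ enter.
partial-fractions : ∀ x J iP iQ iJ → (J - x) * iP ≡ 1ℚ → (1ℚ + J - x) * iQ ≡ 1ℚ → J * iJ ≡ 1ℚ →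
                    iP - x * iJ * iQ - iJ ≡ x * iJ * iP * iQ
partial-fractions x J iP iQ iJ PiP≡1 QiQ≡1 JiJ≡1 = begin
  iP - x * iJ * iQ - iJ                          ≡⟨ weigh x iP iQ iJ ⟩
  G 1ℚ 1ℚ 1ℚ                                     ≡⟨ cong₂ (λ a b → G a b 1ℚ) (sym PiP≡1) (sym QiQ≡1) ⟩
  G ((J - x) * iP) ((1ℚ + J - x) * iQ) 1ℚ        ≡⟨ cong (G ((J - x) * iP) ((1ℚ + J - x) * iQ)) (sym JiJ≡1) ⟩
  G ((J - x) * iP) ((1ℚ + J - x) * iQ) (J * iJ)  ≡⟨ cleared x J iP iQ iJ ⟩
  x * iJ * iP * iQ                               ∎
  where
  open ≡-Reasoning
  G : ℚ → ℚ → ℚ → ℚ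
  G a b c = iP * b * c - x * iJ * iQ * a - iJ * a * b
  weigh : ∀ x iP iQ iJ → iP - x * iJ * iQ - iJ ≡ iP * 1ℚ * 1ℚ - x * iJ * iQ * 1ℚ - iJ * 1ℚ * 1ℚ
  weigh = solve-∀ ℚ-ring
  cleared : ∀ x J iP iQ iJ →
            iP * ((1ℚ + J - x) * iQ) * (J * iJ) - x * iJ * iQ * ((J - x) * iP)
              - iJ * ((J - x) * iP) * ((1ℚ + J - x) * iQ)
            ≡ x * iJ * iP * iQ
  cleared = solve-∀ ℚ-ring

module TruncatedExp (x : ℚ) where

  w : ℕ → ℚ
  w k = x ^ k ⊘ fac k

  gap : ℕ → ℚ
  gap k = ⟦ suc k ⟧ - x

  u : ℕ → ℚ
  u k = w k ⊘ gap k

  potential : ℕ → ℚ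
  potential k = u k + inv x * expPartial x (suc k)

  w-suc : ∀ k → w (suc k) ≡ x * w k * inv ⟦ suc k ⟧
  w-suc k = begin
    x * x ^ k * inv (fac (suc k))               ≡⟨ cong (λ f → x * x ^ k * inv f) (fac-suc k) ⟩
    x * x ^ k * inv (⟦ suc k ⟧ * fac k)         ≡⟨ cong (x * x ^ k *_) (inv-* ⟦ suc k ⟧ (fac k)) ⟩
    x * x ^ k * (inv ⟦ suc k ⟧ * inv (fac k))   ≡⟨ regroup x (x ^ k) (inv ⟦ suc k ⟧) (inv (fac k)) ⟩
    x * (x ^ k * inv (fac k)) * inv ⟦ suc k ⟧   ∎
    where
    open ≡-Reasoning
    regroup : ∀ a b c d → a * b * (c * d) ≡ a * (b * d) * c
    regroup = solve-∀ ℚ-ring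

  module InUnitInterval (0<x : 0ℚ ℚ.< x) (x<1 : x ℚ.< 1ℚ) where

    gap-pos : ∀ k → 0ℚ ℚ.< gap k
    gap-pos k = p<q⇒0<q-p (ℚ.<-≤-trans x<1 (⟦⟧-mono-≤ {1} {suc k} (s≤s z≤n)))

    gap-≥-1 : ∀ {k} → 1 ≤ k → 1ℚ ℚ.≤ gap k
    gap-≥-1 {k} 1≤k = begin
      1ℚ                 ≡⟨ ℚ.+-identityʳ 1ℚ ⟨
      1ℚ + 0ℚ            ≤⟨ ℚ.+-monoʳ-≤ 1ℚ (p≤q⇒0≤q-p (ℚ.≤-trans (ℚ.<⇒≤ x<1) (⟦⟧-mono-≤ 1≤k))) ⟩
      1ℚ + (⟦ k ⟧ - x)   ≡⟨ ℚ.+-assoc 1ℚ ⟦ k ⟧ (- x) ⟨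
      1ℚ + ⟦ k ⟧ - x     ≡⟨ cong (_- x) (⟦⟧-suc k) ⟨
      gap k              ∎
      where open ℚ.≤-Reasoning

    w-nonNeg : ∀ k → 0ℚ ℚ.≤ w k
    w-nonNeg k = *-nonNeg (pow-nonNeg k (ℚ.<⇒≤ 0<x)) (ℚ.<⇒≤ (inv-pos (fac-pos k)))

    w-≤-harmonic : ∀ {m k} → 1 ≤ m → m ≤ k → w k ℚ.≤ inv ⟦ m ⟧
    w-≤-harmonic {m} {k} 1≤m m≤k = begin
      x ^ k * inv (fac k)   ≤⟨ *-monoʳ-≤-0≤ (ℚ.<⇒≤ (inv-pos (fac-pos k))) (pow-≤-1 k (ℚ.<⇒≤ 0<x) (ℚ.<⇒≤ x<1)) ⟩
      1ℚ * inv (fac k)      ≡⟨ ℚ.*-identityˡ (inv (fac k)) ⟩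
      inv (fac k)           ≤⟨ inv-antimono-≤ (⟦⟧-pos 1≤k) (⟦⟧-≤-fac k) ⟩
      inv ⟦ k ⟧             ≤⟨ inv-antimono-≤ (⟦⟧-pos 1≤m) (⟦⟧-mono-≤ m≤k) ⟩
      inv ⟦ m ⟧             ∎
      where
      open ℚ.≤-Reasoning
      1≤k : 1 ≤ k
      1≤k = ℕ.≤-trans 1≤m m≤k

    u-nonNeg : ∀ k → 0ℚ ℚ.≤ u k
    u-nonNeg k = *-nonNeg (w-nonNeg k) (ℚ.<⇒≤ (inv-pos (gap-pos k)))

    u-≤-w : ∀ {k} → 1 ≤ k → u k ℚ.≤ w k
    u-≤-w {k} 1≤k = begin
      w k * inv (gap k)   ≤⟨ *-monoˡ-≤-0≤ (w-nonNeg k) (inv-antimono-≤ (ℚ.positive⁻¹ 1ℚ) (gap-≥-1 1≤k)) ⟩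
      w k * 1ℚ            ≡⟨ ℚ.*-identityʳ (w k) ⟩
      w k                 ∎
      where open ℚ.≤-Reasoning

    potential-step : ∀ k → w (suc k) ⊘ (gap k * gap (suc k)) ≡ potential k - potential (suc k)
    potential-step k = sym (begin
      potential k - potential (suc k)
        ≡⟨ unfold (u k) (u (suc k)) iX (expPartial x (suc k)) (w (suc k)) ⟩
      W * iP - w (suc k) * iQ - iX * w (suc k)
        ≡⟨ cong (λ v → W * iP - v * iQ - iX * v) (w-suc k) ⟩
      W * iP - x * W * iJ * iQ - iX * (x * W * iJ)
        ≡⟨ factor x W iX iJ iP iQ ⟩
      W * (iP - x * iJ * iQ - iX * x * iJ)
        ≡⟨ cong (λ c → W * (iP - x * iJ * iQ - c * iJ)) iXx≡1 ⟩
      W * (iP - x * iJ * iQ - 1ℚ * iJ)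
        ≡⟨ cong (λ c → W * (iP - x * iJ * iQ - c)) (ℚ.*-identityˡ iJ) ⟩
      W * (iP - x * iJ * iQ - iJ)
        ≡⟨ cong (W *_) (partial-fractions x J iP iQ iJ PiP≡1 QiQ≡1 JiJ≡1) ⟩
      W * (x * iJ * iP * iQ)
        ≡⟨ regroup x W iJ iP iQ ⟩
      x * W * iJ * (iP * iQ)
        ≡⟨ cong₂ _*_ (w-suc k) (inv-* (gap k) (gap (suc k))) ⟨
      w (suc k) ⊘ (gap k * gap (suc k))
        ∎)
      where
      open ≡-Reasoning
      W J iJ iP iQ iX : ℚ
      W  = w k
      J  = ⟦ suc k ⟧
      iJ = inv J
      iP = inv (gap k)
      iQ = inv (gap (suc k))
      iX = inv x
      PiP≡1 : (J - x) * iP ≡ 1ℚ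
      PiP≡1 = inv-inverseʳ (gap k) (pos⇒≢0 (gap-pos k))
      QiQ≡1 : (1ℚ + J - x) * iQ ≡ 1ℚ
      QiQ≡1 = trans (cong (λ s → (s - x) * iQ) (sym (⟦⟧-suc (suc k))))
                    (inv-inverseʳ (gap (suc k)) (pos⇒≢0 (gap-pos (suc k))))
      JiJ≡1 : J * iJ ≡ 1ℚ
      JiJ≡1 = inv-inverseʳ J (pos⇒≢0 (⟦⟧-pos {suc k} (s≤s z≤n)))
      iXx≡1 : iX * x ≡ 1ℚ
      iXx≡1 = trans (ℚ.*-comm iX x) (inv-inverseʳ x (pos⇒≢0 0<x))
      unfold : ∀ a b c S e → (a + c * S) - (b + c * (S + e)) ≡ a - b - c * e
      unfold = solve-∀ ℚ-ring
      factor : ∀ x W iX iJ iP iQ → W * iP - x * W * iJ * iQ - iX * (x * W * iJ)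
                                   ≡ W * (iP - x * iJ * iQ - iX * x * iJ)
      factor = solve-∀ ℚ-ring
      regroup : ∀ x W iJ iP iQ → W * (x * iJ * iP * iQ) ≡ x * W * iJ * (iP * iQ)
      regroup = solve-∀ ℚ-ring

    potential-step-nonNeg : ∀ k → 0ℚ ℚ.≤ potential k - potential (suc k)
    potential-step-nonNeg k = subst (0ℚ ℚ.≤_) (potential-step k)
      (*-nonNeg (w-nonNeg (suc k)) (ℚ.<⇒≤ (inv-pos (*-pos (gap-pos k) (gap-pos (suc k))))))

    potential-drop-nonNeg : ∀ d i → 0ℚ ℚ.≤ potential i - potential (d ℕ.+ i)
    potential-drop-nonNeg zero    i = ℚ.≤-reflexive (sym (ℚ.+-inverseʳ (potential i)))
    potential-drop-nonNeg (suc d) i =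
      subst (0ℚ ℚ.≤_) (split (potential i) (potential (d ℕ.+ i)) (potential (suc d ℕ.+ i)))
            (+-nonNeg (potential-drop-nonNeg d i) (potential-step-nonNeg (d ℕ.+ i)))
      where
      split : ∀ a b c → (a - b) + (b - c) ≡ a - c
      split = solve-∀ ℚ-ring

    potential-drop-≤-u : ∀ d i → potential i - potential (d ℕ.+ i) ℚ.≤ u i
    potential-drop-≤-u d i = begin
      potential i - potential (d ℕ.+ i)   ≤⟨ ℚ.+-monoʳ-≤ (potential i) (ℚ.neg-antimono-≤ below) ⟩
      potential i - iX * E (suc i)        ≡⟨ cancel (u i) (iX * E (suc i)) ⟩
      u i                                 ∎
      where
      open ℚ.≤-Reasoning
      iX : ℚ
      iX = inv x
      E : ℕ → ℚ
      E = expPartial x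
      below : iX * E (suc i) ℚ.≤ potential (d ℕ.+ i)
      below = begin
        iX * E (suc i)
          ≤⟨ *-monoˡ-≤-0≤ (ℚ.<⇒≤ (inv-pos 0<x)) (sumTo-mono-≤ w-nonNeg (s≤s (ℕ.m≤n+m i d))) ⟩
        iX * E (suc (d ℕ.+ i))
          ≡⟨ ℚ.+-identityˡ (iX * E (suc (d ℕ.+ i))) ⟨
        0ℚ + iX * E (suc (d ℕ.+ i))
          ≤⟨ ℚ.+-monoˡ-≤ (iX * E (suc (d ℕ.+ i))) (u-nonNeg (d ℕ.+ i)) ⟩
        potential (d ℕ.+ i)
          ∎
      cancel : ∀ a b → a + b - b ≡ a
      cancel = solve-∀ ℚ-ring

    potential-drop-bound : ∀ {m i j} → 1 ≤ m → m ≤ i → i ≤ j →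
                           ∣ potential j - potential i ∣ ℚ.≤ inv ⟦ m ⟧
    potential-drop-bound {m} {i} {j} 1≤m m≤i i≤j = begin
      ∣ potential j - potential i ∣   ≡⟨ ∣-∣-comm (potential j) (potential i) ⟩
      ∣ potential i - potential j ∣   ≡⟨ cong (λ k → ∣ potential i - potential k ∣) (ℕ.m∸n+n≡m i≤j) ⟨
      ∣ drop ∣                        ≡⟨ ℚ.0≤p⇒∣p∣≡p (potential-drop-nonNeg (j ℕ.∸ i) i) ⟩
      drop                            ≤⟨ potential-drop-≤-u (j ℕ.∸ i) i ⟩
      u i                             ≤⟨ u-≤-w (ℕ.≤-trans 1≤m m≤i) ⟩
      w i                             ≤⟨ w-≤-harmonic 1≤m m≤i ⟩
      inv ⟦ m ⟧                       ∎
      where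
      open ℚ.≤-Reasoning
      drop : ℚ
      drop = potential i - potential (j ℕ.∸ i ℕ.+ i)

    potential-excess-bound : ∀ d {m} → 1 ≤ m →
      ∣ inv x * expPartial x m - potential (d ℕ.+ m) ∣ ℚ.≤ (1ℚ + inv x * ⟦ suc d ⟧) ⊘ ⟦ m ⟧
    potential-excess-bound d {m} 1≤m = begin
      ∣ iX * E m - potential (d ℕ.+ m) ∣        ≡⟨ ∣-∣-comm (iX * E m) (potential (d ℕ.+ m)) ⟩
      ∣ potential (d ℕ.+ m) - iX * E m ∣        ≡⟨ cong ∣_∣ excess≡ ⟩
      ∣ excess ∣                                ≡⟨ ℚ.0≤p⇒∣p∣≡p 0≤excess ⟩
      excess                                    ≤⟨ ℚ.+-mono-≤ u≤ (*-monoˡ-≤-0≤ 0≤iX (sumTo-tail-≤ w≤ (suc d))) ⟩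
      inv ⟦ m ⟧ + iX * (⟦ suc d ⟧ * inv ⟦ m ⟧)  ≡⟨ collect iX ⟦ suc d ⟧ (inv ⟦ m ⟧) ⟩
      (1ℚ + iX * ⟦ suc d ⟧) * inv ⟦ m ⟧         ∎
      where
      open ℚ.≤-Reasoning
      iX : ℚ
      iX = inv x
      0≤iX : 0ℚ ℚ.≤ iX
      0≤iX = ℚ.<⇒≤ (inv-pos 0<x)
      E : ℕ → ℚ
      E = expPartial x
      excess : ℚ
      excess = u (d ℕ.+ m) + iX * (E (suc d ℕ.+ m) - E m)
      excess≡ : potential (d ℕ.+ m) - iX * E m ≡ excess
      excess≡ = factor (u (d ℕ.+ m)) iX (E (suc d ℕ.+ m)) (E m)
        where
        factor : ∀ a c S T → a + c * S - c * T ≡ a + c * (S - T)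
        factor = solve-∀ ℚ-ring
      0≤excess : 0ℚ ℚ.≤ excess
      0≤excess = +-nonNeg (u-nonNeg (d ℕ.+ m))
                          (*-nonNeg 0≤iX (p≤q⇒0≤q-p (sumTo-mono-≤ w-nonNeg (ℕ.m≤n+m m (suc d)))))
      u≤ : u (d ℕ.+ m) ℚ.≤ inv ⟦ m ⟧
      u≤ = ℚ.≤-trans (u-≤-w (ℕ.≤-trans 1≤m (ℕ.m≤n+m m d))) (w-≤-harmonic 1≤m (ℕ.m≤n+m m d))
      w≤ : ∀ k → m ≤ k → w k ℚ.≤ inv ⟦ m ⟧
      w≤ k = w-≤-harmonic 1≤m
      collect : ∀ c s i → i + c * (s * i) ≡ (1ℚ + c * s) * i
      collect = solve-∀ ℚ-ring

module Hypergeometric (ℓ : ℕ) {x α : ℚ} (α≡ : α ≡ ⟦ suc ℓ ⟧ - x) (0<x : 0ℚ ℚ.< x) (x<1 : x ℚ.< 1ℚ) where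
  open TruncatedExp x
  open InUnitInterval 0<x x<1

  series : ℕ → ℚ
  series = F22partial α 1ℚ (⟦ ℓ ⟧ + ⟦ 2 ⟧) (α + ⟦ 2 ⟧) x

  C : ℚ
  C = fac (suc ℓ) * inv (x ^ suc ℓ) * (α * (α + 1ℚ))

  limit : ℕ → ℚ
  limit m = C * (inv x * (expPartial x (suc ℓ) - expPartial x m) + u ℓ)

  0<α : 0ℚ ℚ.< α
  0<α = subst (0ℚ ℚ.<_) (sym α≡) (gap-pos ℓ)

  0≤C : 0ℚ ℚ.≤ C
  0≤C = *-nonNeg (*-nonNeg (ℚ.<⇒≤ (fac-pos (suc ℓ))) (ℚ.<⇒≤ (inv-pos (pow-pos (suc ℓ) 0<x))))
                 (ℚ.<⇒≤ (*-pos 0<α (+-pos 0<α (ℚ.nonNegative⁻¹ 1ℚ))))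

  α+⟦⟧≡gap : ∀ m → α + ⟦ m ⟧ ≡ gap (ℓ ℕ.+ m)
  α+⟦⟧≡gap m = begin
    α + ⟦ m ⟧               ≡⟨ cong (_+ ⟦ m ⟧) α≡ ⟩
    ⟦ suc ℓ ⟧ - x + ⟦ m ⟧   ≡⟨ swap ⟦ suc ℓ ⟧ x ⟦ m ⟧ ⟩
    ⟦ suc ℓ ⟧ + ⟦ m ⟧ - x   ≡⟨ cong (_- x) (⟦⟧-homo-+ (suc ℓ) m) ⟨
    gap (ℓ ℕ.+ m)           ∎
    where
    open ≡-Reasoning
    swap : ∀ s x m → s - x + m ≡ s + m - x
    swap = solve-∀ ℚ-ring

  α+⟦⟧+1≡gap : ∀ m → α + ⟦ m ⟧ + 1ℚ ≡ gap (suc (ℓ ℕ.+ m))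
  α+⟦⟧+1≡gap m = begin
    α + ⟦ m ⟧ + 1ℚ                 ≡⟨ cong (_+ 1ℚ) (α+⟦⟧≡gap m) ⟩
    ⟦ suc (ℓ ℕ.+ m) ⟧ - x + 1ℚ     ≡⟨ swap ⟦ suc (ℓ ℕ.+ m) ⟧ x ⟩
    1ℚ + ⟦ suc (ℓ ℕ.+ m) ⟧ - x     ≡⟨ cong (_- x) (⟦⟧-suc (suc (ℓ ℕ.+ m))) ⟨
    gap (suc (ℓ ℕ.+ m))            ∎
    where
    open ≡-Reasoning
    swap : ∀ s x → s - x + 1ℚ ≡ 1ℚ + s - x
    swap = solve-∀ ℚ-ring

  term-closed-form : ∀ m → term22 α 1ℚ (⟦ ℓ ⟧ + ⟦ 2 ⟧) (α + ⟦ 2 ⟧) x m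
                           ≡ C * (w (suc (ℓ ℕ.+ m)) ⊘ (gap (ℓ ℕ.+ m) * gap (suc (ℓ ℕ.+ m))))
  term-closed-form m = begin
    Pα * P1 ⊘ (Pb₁ * Pb₂) * (x ^ m ⊘ fac m)
      ≡⟨ cong (λ i → Pα * P1 * i * (x ^ m ⊘ fac m)) (inv-* Pb₁ Pb₂) ⟩
    Pα * P1 * (inv Pb₁ * inv Pb₂) * (x ^ m ⊘ fac m)
      ≡⟨ regroup Pα P1 (inv Pb₁) (inv Pb₂) (x ^ m) (inv (fac m)) ⟩
    Pα ⊘ Pb₂ * inv Pb₁ * x ^ m * (P1 ⊘ fac m)
      ≡⟨ cong₂ (λ r i → r * i * x ^ m * (P1 ⊘ fac m)) ratio inv-Pb₁ ⟩
    αα ⊘ D * (F ⊘ fac j) * x ^ m * (P1 ⊘ fac m)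
      ≡⟨ cong (λ e → αα ⊘ D * (F ⊘ fac j) * x ^ m * e) P1/m!≡1 ⟩
    αα ⊘ D * (F ⊘ fac j) * x ^ m * 1ℚ
      ≡⟨ cong (λ e → αα ⊘ D * (F ⊘ fac j) * x ^ m * e) X/X≡1 ⟨
    αα ⊘ D * (F ⊘ fac j) * x ^ m * (X ⊘ X)
      ≡⟨ regroup′ αα (inv D) F (inv (fac j)) (x ^ m) X (inv X) ⟩
    F * inv X * αα * (X * x ^ m * inv (fac j) * inv D)
      ≡⟨ cong (λ p → C * (p * inv (fac j) * inv D)) (pow-+ x (suc ℓ) m) ⟨
    C * (w j ⊘ D)
      ∎
    where
    open ≡-Reasoning
    j : ℕ
    j = suc (ℓ ℕ.+ m)
    Pα P1 Pb₁ Pb₂ αα F X D : ℚ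
    Pα  = poch α m
    P1  = poch 1ℚ m
    Pb₁ = poch (⟦ ℓ ⟧ + ⟦ 2 ⟧) m
    Pb₂ = poch (α + ⟦ 2 ⟧) m
    αα  = α * (α + 1ℚ)
    F   = fac (suc ℓ)
    X   = x ^ suc ℓ
    D   = gap (ℓ ℕ.+ m) * gap j
    ratio : Pα ⊘ Pb₂ ≡ αα ⊘ D
    ratio = trans (poch-ratio-shift-2 m 0<α)
                  (cong (λ e → αα ⊘ e) (cong₂ _*_ (α+⟦⟧≡gap m) (α+⟦⟧+1≡gap m)))
    inv-Pb₁ : inv Pb₁ ≡ F ⊘ fac j
    inv-Pb₁ = trans (cong (λ b → inv (poch b m)) (trans (sym (⟦⟧-homo-+ ℓ 2)) (cong ⟦_⟧ (ℕ.+-comm ℓ 2))))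
                    (inv-poch-⟦⟧ (suc ℓ) m)
    P1/m!≡1 : P1 ⊘ fac m ≡ 1ℚ
    P1/m!≡1 = trans (cong (_⊘ fac m) (poch-1 m)) (inv-inverseʳ (fac m) (pos⇒≢0 (fac-pos m)))
    X/X≡1 : X ⊘ X ≡ 1ℚ
    X/X≡1 = inv-inverseʳ X (pos⇒≢0 (pow-pos (suc ℓ) 0<x))
    regroup : ∀ a p ib ic y iF → a * p * (ib * ic) * (y * iF) ≡ a * ic * ib * y * (p * iF)
    regroup = solve-∀ ℚ-ring
    regroup′ : ∀ r iD F iJ y X iX → r * iD * (F * iJ) * y * (X * iX) ≡ F * iX * r * (X * y * iJ * iD)
    regroup′ = solve-∀ ℚ-ring

  term-telescopes : ∀ k → term22 α 1ℚ (⟦ ℓ ⟧ + ⟦ 2 ⟧) (α + ⟦ 2 ⟧) x k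
                          ≡ C * (potential (ℓ ℕ.+ k) - potential (ℓ ℕ.+ suc k))
  term-telescopes k = begin
    term22 α 1ℚ (⟦ ℓ ⟧ + ⟦ 2 ⟧) (α + ⟦ 2 ⟧) x k
      ≡⟨ term-closed-form k ⟩
    C * (w (suc (ℓ ℕ.+ k)) ⊘ (gap (ℓ ℕ.+ k) * gap (suc (ℓ ℕ.+ k))))
      ≡⟨ cong (C *_) (potential-step (ℓ ℕ.+ k)) ⟩
    C * (potential (ℓ ℕ.+ k) - potential (suc (ℓ ℕ.+ k)))
      ≡⟨ cong (λ i → C * (potential (ℓ ℕ.+ k) - potential i)) (ℕ.+-suc ℓ k) ⟨
    C * (potential (ℓ ℕ.+ k) - potential (ℓ ℕ.+ suc k))
      ∎
    where open ≡-Reasoning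

  series-closed-form : ∀ m → series m ≡ C * (potential ℓ - potential (ℓ ℕ.+ m))
  series-closed-form m = begin
    series m
      ≡⟨ sumTo-telescope C (λ k → potential (ℓ ℕ.+ k)) _ term-telescopes m ⟩
    C * (potential (ℓ ℕ.+ 0) - potential (ℓ ℕ.+ m))
      ≡⟨ cong (λ i → C * (potential i - potential (ℓ ℕ.+ m))) (ℕ.+-identityʳ ℓ) ⟩
    C * (potential ℓ - potential (ℓ ℕ.+ m))
      ∎
    where open ≡-Reasoning

  isCauchy : IsCauchy series
  isCauchy = cauchy-by-harmonic-bound series 0≤C bound
    where
    bound : ∀ i j → 1 ≤ i → i ≤ j → ∣ series i - series j ∣ ℚ.≤ C ⊘ ⟦ i ⟧
    bound i j 1≤i i≤j = begin
      ∣ series i - series j ∣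
        ≡⟨ cong ∣_∣ (cong₂ _-_ (series-closed-form i) (series-closed-form j)) ⟩
      ∣ C * (P ℓ - P (ℓ ℕ.+ i)) - C * (P ℓ - P (ℓ ℕ.+ j)) ∣
        ≡⟨ cong ∣_∣ (cancel C (P ℓ) (P (ℓ ℕ.+ i)) (P (ℓ ℕ.+ j))) ⟩
      ∣ C * P (ℓ ℕ.+ j) - C * P (ℓ ℕ.+ i) ∣
        ≡⟨ ∣c*p-c*q∣≡c*∣p-q∣ 0≤C (P (ℓ ℕ.+ j)) (P (ℓ ℕ.+ i)) ⟩
      C * ∣ P (ℓ ℕ.+ j) - P (ℓ ℕ.+ i) ∣
        ≤⟨ *-monoˡ-≤-0≤ 0≤C (potential-drop-bound 1≤i (ℕ.m≤n+m i ℓ) (ℕ.+-monoʳ-≤ ℓ i≤j)) ⟩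
      C ⊘ ⟦ i ⟧
        ∎
      where
      open ℚ.≤-Reasoning
      P : ℕ → ℚ
      P = potential
      cancel : ∀ c a b d → c * (a - b) - c * (a - d) ≡ c * d - c * b
      cancel = solve-∀ ℚ-ring

  limEq : LimEq series limit
  limEq = limEq-by-harmonic-bound series limit (*-nonNeg 0≤C 0≤K) bound
    where
    K : ℚ
    K = 1ℚ + inv x * ⟦ suc ℓ ⟧
    0≤K : 0ℚ ℚ.≤ K
    0≤K = +-nonNeg (ℚ.nonNegative⁻¹ 1ℚ) (*-nonNeg (ℚ.<⇒≤ (inv-pos 0<x)) (⟦⟧-nonNeg (suc ℓ)))
    bound : ∀ m → 1 ≤ m → ∣ series m - limit m ∣ ℚ.≤ C * K ⊘ ⟦ m ⟧
    bound m 1≤m = begin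
      ∣ series m - limit m ∣
        ≡⟨ cong ∣_∣ (cong (_- limit m) (series-closed-form m)) ⟩
      ∣ C * (P ℓ - P (ℓ ℕ.+ m)) - limit m ∣
        ≡⟨ cong ∣_∣ (cancel C (u ℓ) (inv x) (E (suc ℓ)) (E m) (P (ℓ ℕ.+ m))) ⟩
      ∣ C * (inv x * E m) - C * P (ℓ ℕ.+ m) ∣
        ≡⟨ ∣c*p-c*q∣≡c*∣p-q∣ 0≤C (inv x * E m) (P (ℓ ℕ.+ m)) ⟩
      C * ∣ inv x * E m - P (ℓ ℕ.+ m) ∣
        ≤⟨ *-monoˡ-≤-0≤ 0≤C (potential-excess-bound ℓ 1≤m) ⟩
      C * (K ⊘ ⟦ m ⟧)
        ≡⟨ ℚ.*-assoc C K (inv ⟦ m ⟧) ⟨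
      C * K ⊘ ⟦ m ⟧
        ∎
      where
      open ℚ.≤-Reasoning
      P E : ℕ → ℚ
      P = potential
      E = expPartial x
      cancel : ∀ c v i S T p → c * ((v + i * S) - p) - c * (i * (S - T) + v) ≡ c * (i * T) - c * p
      cancel = solve-∀ ℚ-ring

module Specialisation (l n : ℕ) (ℓ<n : suc l < n) where
  ℓ : ℕ
  ℓ = suc l

  L N x : ℚ
  L = ⟦ ℓ ⟧
  N = ⟦ n ⟧
  x = xval ℓ n

  open TruncatedExp x using (u; gap)

  0<L : 0ℚ ℚ.< L
  0<L = ⟦⟧-pos {ℓ} (s≤s z≤n)

  0<N : 0ℚ ℚ.< N
  0<N = ⟦⟧-pos (ℕ.≤-trans (s≤s z≤n) ℓ<n)

  N/N≡1 : N ⊘ N ≡ 1ℚ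
  N/N≡1 = inv-inverseʳ N (pos⇒≢0 0<N)

  0<x : 0ℚ ℚ.< x
  0<x = *-pos 0<L (inv-pos 0<N)

  x<1 : x ℚ.< 1ℚ
  x<1 = ℚ.<-≤-trans (ℚ.*-monoˡ-<-pos (inv N) {{ℚ.positive (inv-pos 0<N)}} (⟦⟧-mono-< ℓ<n))
                    (ℚ.≤-reflexive N/N≡1)

  alpha≡ : alpha ℓ n ≡ ⟦ suc ℓ ⟧ - x
  alpha≡ = begin
    (N - 1ℚ) * inv N * L + 1ℚ       ≡⟨ expand N (inv N) L ⟩
    N ⊘ N * L - L * inv N + 1ℚ      ≡⟨ cong (λ c → c * L - L * inv N + 1ℚ) N/N≡1 ⟩
    1ℚ * L - L * inv N + 1ℚ         ≡⟨ collect L (inv N) ⟩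
    1ℚ + L - x                      ≡⟨ cong (_- x) (⟦⟧-suc ℓ) ⟨
    ⟦ suc ℓ ⟧ - x                   ∎
    where
    open ≡-Reasoning
    expand : ∀ N iN L → (N - 1ℚ) * iN * L + 1ℚ ≡ N * iN * L - L * iN + 1ℚ
    expand = solve-∀ ℚ-ring
    collect : ∀ L iN → 1ℚ * L - L * iN + 1ℚ ≡ 1ℚ + L - L * iN
    collect = solve-∀ ℚ-ring

  inv-x≡ : inv x ≡ N ⊘ L
  inv-x≡ = inv-⊘ L N

  inv-x^≡ : ∀ k → inv (x ^ k) ≡ N ^ k ⊘ L ^ k
  inv-x^≡ k = begin
    inv (x ^ k)               ≡⟨ cong inv (pow-* L (inv N) k) ⟩
    inv (L ^ k * inv N ^ k)   ≡⟨ cong (λ p → inv (L ^ k * p)) (inv-pow N k) ⟨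
    inv (L ^ k ⊘ N ^ k)       ≡⟨ inv-⊘ (L ^ k) (N ^ k) ⟩
    N ^ k ⊘ L ^ k             ∎
    where open ≡-Reasoning

  denominator≡ : (N + 1ℚ) * (L + 1ℚ) - 1ℚ - ⟦ 2 ⟧ * L ≡ N * gap ℓ
  denominator≡ = begin
    (N + 1ℚ) * (L + 1ℚ) - 1ℚ - ⟦ 2 ⟧ * L        ≡⟨ expand N (inv N) L ⟩
    N * (1ℚ + L - L * inv N) + L * (N ⊘ N) - L  ≡⟨ cong (λ c → N * (1ℚ + L - x) + L * c - L) N/N≡1 ⟩
    N * (1ℚ + L - x) + L * 1ℚ - L               ≡⟨ cancel (N * (1ℚ + L - x)) L ⟩
    N * (1ℚ + L - x)                            ≡⟨ cong (λ s → N * (s - x)) (⟦⟧-suc ℓ) ⟨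
    N * gap ℓ                                   ∎
    where
    open ≡-Reasoning
    expand : ∀ N iN L → (N + 1ℚ) * (L + 1ℚ) - 1ℚ - ⟦ 2 ⟧ * L
                        ≡ N * (1ℚ + L - L * iN) + L * (N * iN) - L
    expand = solve-∀ ℚ-ring
    cancel : ∀ a L → a + L * 1ℚ - L ≡ a
    cancel = solve-∀ ℚ-ring

  correction≡u : L ^ l ⊘ (fac l * N ^ l) * inv ((N + 1ℚ) * (L + 1ℚ) - 1ℚ - ⟦ 2 ⟧ * L) ≡ u ℓ
  correction≡u = begin
    L ^ l * inv (fac l * N ^ l) * inv ((N + 1ℚ) * (L + 1ℚ) - 1ℚ - ⟦ 2 ⟧ * L)
      ≡⟨ cong₂ (λ a b → L ^ l * a * b) inv-fac-pow inv-denominator ⟩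
    L ^ l * (iF * iN ^ l) * (iN * iG)
      ≡⟨ ℚ.*-identityˡ _ ⟨
    1ℚ * (L ^ l * (iF * iN ^ l) * (iN * iG))
      ≡⟨ cong (_* (L ^ l * (iF * iN ^ l) * (iN * iG))) (inv-inverseʳ L (pos⇒≢0 0<L)) ⟨
    L ⊘ L * (L ^ l * (iF * iN ^ l) * (iN * iG))
      ≡⟨ regroup L (inv L) (L ^ l) iF (iN ^ l) iN iG ⟩
    L * L ^ l * (iN * iN ^ l) * (inv L * iF) * iG
      ≡⟨ cong₂ (λ a b → a * b * iG) (pow-* L iN ℓ) inv-fac ⟨
    x ^ ℓ * inv (fac ℓ) * iG
      ∎
    where
    open ≡-Reasoning
    iF iN iG : ℚ
    iF = inv (fac l)
    iN = inv N
    iG = inv (gap ℓ)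
    inv-fac-pow : inv (fac l * N ^ l) ≡ iF * iN ^ l
    inv-fac-pow = trans (inv-* (fac l) (N ^ l)) (cong (iF *_) (inv-pow N l))
    inv-denominator : inv ((N + 1ℚ) * (L + 1ℚ) - 1ℚ - ⟦ 2 ⟧ * L) ≡ iN * iG
    inv-denominator = trans (cong inv denominator≡) (inv-* N (gap ℓ))
    inv-fac : inv (fac ℓ) ≡ inv L * iF
    inv-fac = trans (cong inv (fac-suc l)) (inv-* L (fac l))
    regroup : ∀ L iL A iF B iN iG → L * iL * (A * (iF * B) * (iN * iG))
                                    ≡ L * A * (iN * B) * (iL * iF) * iG
    regroup = solve-∀ ℚ-ring

  rhsPartial≡ : ∀ m → rhsPartial ℓ n m
                      ≡ fac (suc ℓ) * inv (x ^ suc ℓ) * gammaRatio ℓ n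
                        * (inv x * (expPartial x (suc ℓ) - expPartial x m) + u ℓ)
  rhsPartial≡ m = begin
    shape (N ^ suc ℓ ⊘ L ^ suc ℓ) (N ⊘ L) correction
      ≡⟨ cong₂ (λ A B → shape A B correction) (sym (inv-x^≡ (suc ℓ))) (sym inv-x≡) ⟩
    shape (inv (x ^ suc ℓ)) (inv x) correction
      ≡⟨ cong (shape (inv (x ^ suc ℓ)) (inv x)) correction≡u ⟩
    shape (inv (x ^ suc ℓ)) (inv x) (u ℓ)
      ∎
    where
    open ≡-Reasoning
    shape : ℚ → ℚ → ℚ → ℚ
    shape A B c = fac (suc ℓ) * A * gammaRatio ℓ n * (B * (expPartial x (suc ℓ) - expPartial x m) + c)
    correction : ℚ
    correction = L ^ l ⊘ (fac l * N ^ l) * inv ((N + 1ℚ) * (L + 1ℚ) - 1ℚ - ⟦ 2 ⟧ * L)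

lemma4p2 : (ℓ n : ℕ) → 1 ≤ ℓ → ℓ < n →
    IsCauchy (lhsPartial ℓ n) × LimEq (lhsPartial ℓ n) (rhsPartial ℓ n)
lemma4p2 zero    n ()  _
lemma4p2 (suc l) n _ ℓ<n =
  isCauchy , LimEq-congʳ {lhsPartial (suc l) n} (λ m → sym (rhsPartial≡ m)) limEq
  where
  open Specialisation l n ℓ<n using (alpha≡; 0<x; x<1; rhsPartial≡)
  open Hypergeometric (suc l) alpha≡ 0<x x<1 using (isCauchy; limEq)
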